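{- Let $G=(V,E)$ be a cocomparability graph, let $\pi$ be an umbrella-free ordering of $V$, and let $\pi'=\mathrm{RMN}(\pi)$. Let $x,y\in V$ be such that $y<_\pi x$ and $y<_{\pi'} x$. Then $y$ is not the first vertex of $\pi'$, and for the vertex $z$ immediately preceding $y$ in $\pi'$ we have $y<_\pi x<_\pi z$, $zy\in E$, and $zx\notin E$.
   Context: Graphs are finite, simple, undirected. An ordering $\pi$ of $V$ is umbrella-free if for all $x<_\pi y<_\pi z$, $xz\in E$ implies $xy\in E$ or $yz\in E$. The RightMost-Neighbor procedure $\mathrm{RMN}(\sigma)$, for an ordering $\sigma$ of $V$, produces an ordering $\widehat\sigma$ of $V$ as follows: initially all vertices are unvisited; while there are unvisited vertices, take the rightmost (in $\sigma$) unvisited vertex $x$, append it to $\widehat\sigma$ and mark it visited; then, while the current vertex $x$ has an unvisited neighbor, let $y$ be the rightmost (in $\sigma$) unvisited neighbor of $x$, append $y$ to $\widehat\sigma$, mark it visited, and set $x\leftarrow y$. The output $\widehat\sigma$ is the order in which vertices were appended. -}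

module Defs where

open import Data.Nat using (ℕ; zero; suc)
open import Data.Fin using (Fin; _≟_)
open import Data.Bool using (Bool; true; false)
open import Data.Maybe using (Maybe; just; nothing)
open import Data.List using (List; []; _∷_; _++_; length; filter)
open import Data.List.Membership.Propositional using (_∈_)
open import Data.List.Relation.Unary.Unique.Propositional using (Unique)
open import Data.Product using (Σ; _×_; ∃; ∃-syntax)
open import Data.Sum using (_⊎_)
open import Relation.Nullary using (¬_; ¬?)
open import Relation.Binary.PropositionalEquality using (_≡_; _≢_)

record Graph (n : ℕ) : Set where
  field
    adj    : Fin n → Fin n → Bool
    sym    : ∀ u v → adj u v ≡ adj v u
    irrefl : ∀ u → adj u u ≡ false

module _ {n : ℕ} (G : Graph n) where
  open Graph G

  Edge : Fin n → Fin n → Set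
  Edge u v = adj u v ≡ true

  -- G is a cocomparability graph: its complement admits a transitive
  -- orientation, i.e. a strict order R on V whose comparable pairs are
  -- exactly the pairs of distinct non-adjacent vertices.
  Cocomparability : Set₁
  Cocomparability =
    Σ (Fin n → Fin n → Set) λ R →
         ((∀ u v → R u v → u ≢ v × ¬ Edge u v)
          × (∀ u v → u ≢ v → ¬ Edge u v → R u v ⊎ R v u)
          × (∀ u v → R u v → ¬ R v u)
          × (∀ u v w → R u v → R v w → R u w))

IsOrdering : {n : ℕ} → List (Fin n) → Set
IsOrdering {n} σ = Unique σ × (∀ v → v ∈ σ)

_<[_]_ : {n : ℕ} → Fin n → List (Fin n) → Fin n → Set
x <[ σ ] y = ∃[ as ] ∃[ bs ] (σ ≡ as ++ x ∷ bs × y ∈ bs)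

module _ {n : ℕ} (G : Graph n) where
  open Graph G

  UmbrellaFree : List (Fin n) → Set
  UmbrellaFree π = ∀ x y z → x <[ π ] y → y <[ π ] z → Edge G x z →
                   Edge G x y ⊎ Edge G y z

  lastSat : (Fin n → Bool) → List (Fin n) → Maybe (Fin n)
  lastSat p [] = nothing
  lastSat p (v ∷ vs) with lastSat p vs
  ... | just w = just w
  ... | nothing with p v
  ...   | true = just v
  ...   | false = nothing

  -- next vertex chosen by RMN, given the current vertex (if any) and the
  -- list of unvisited vertices (kept in σ-order).
  choose : Maybe (Fin n) → List (Fin n) → Maybe (Fin n)
  choose nothing us = lastSat (λ _ → true) us
  choose (just x) us with lastSat (adj x) us
  ... | just y = just y
  ... | nothing = lastSat (λ _ → true) us

  remove : Fin n → List (Fin n) → List (Fin n)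
  remove y = filter (λ v → ¬? (v ≟ y))

  rmnGo : ℕ → Maybe (Fin n) → List (Fin n) → List (Fin n)
  rmnGo zero cur us = []
  rmnGo (suc k) cur us with choose cur us
  ... | nothing = []
  ... | just y = y ∷ rmnGo k (just y) (remove y us)

  RMN : List (Fin n) → List (Fin n)
  RMN σ = rmnGo (length σ) nothing σ

-- When RMN(π) visits y while x is still unvisited and y <_π x, y cannot have
-- been taken as the rightmost unvisited vertex, so it was the rightmost
-- unvisited neighbour of its predecessor z: hence zy ∈ E and zx ∉ E. If we
-- had z <_π x, then z also precedes x in π', and the same argument one step
-- earlier gives a predecessor w of z with x <_π w, wz ∈ E and wx ∉ E; the
-- triple z <_π x <_π w is then an umbrella. So x <_π z, by induction on the
-- position of y in π'.
module Submission where

open import Defs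
open import Data.Nat using (ℕ; suc)
open import Data.Fin using (Fin; _≟_)
open import Data.Bool using (true; false)
open import Data.Maybe using (Maybe; just; nothing)
open import Data.Maybe.Relation.Unary.All as Maybe using (just; nothing)
open import Data.List using (List; []; _∷_; _++_; length; foldl)
open import Data.List.Properties using (++-assoc; ∷ʳ-++; foldl-∷ʳ; ∷-injective)
open import Data.List.Reverse using (Reverse; []; _∶_∶ʳ_; reverseView)
open import Data.List.Membership.Propositional using (_∈_; _∉_)
open import Data.List.Membership.Propositional.Properties
  using (∈-++⁺ʳ; ∈-++⁻; ∈-filter⁻; ∈-∃++)
open import Data.List.Relation.Unary.Any using (here; there)
open import Data.List.Relation.Unary.All as All using (All)
open import Data.List.Relation.Unary.Unique.Propositional using (Unique)
open import Data.List.Relation.Unary.AllPairs using (_∷_)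
open import Data.List.Relation.Binary.Sublist.Propositional
  using (_⊆_; []; _∷_; _∷ʳ_; ⊆-refl; ⊆-trans)
open import Data.List.Relation.Binary.Sublist.Propositional.Properties
  using (Any-resp-⊆; filter-⊆)
open import Data.Product using (_×_; ∃-syntax; _,_; proj₁; proj₂)
open import Data.Sum using (_⊎_; inj₁; inj₂)
open import Data.Empty using (⊥-elim)
open import Relation.Nullary using (¬_; ¬?)
open import Relation.Binary.PropositionalEquality

variable
  n : ℕ
  a b v : Fin n
  us vs : List (Fin n)

<-∷ : a <[ vs ] b → a <[ v ∷ vs ] b
<-∷ {v = v} (as , bs , refl , b∈bs) = v ∷ as , bs , refl , b∈bs

<-∷⁻ : a <[ v ∷ vs ] b → (a ≡ v × b ∈ vs) ⊎ a <[ vs ] b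
<-∷⁻ ([]     , bs , refl , b∈bs) = inj₁ (refl , b∈bs)
<-∷⁻ (_ ∷ as , bs , refl , b∈bs) = inj₂ (as , bs , refl , b∈bs)

<-∈ʳ : a <[ vs ] b → b ∈ vs
<-∈ʳ (as , bs , refl , b∈bs) = ∈-++⁺ʳ as (there b∈bs)

<-asym : Unique vs → a <[ vs ] b → ¬ b <[ vs ] a
<-asym {vs = []} _ ([] , _ , () , _)
<-asym {vs = []} _ (_ ∷ _ , _ , () , _)
<-asym {vs = v ∷ vs} (v∉vs ∷ u) a<b b<a with <-∷⁻ a<b | <-∷⁻ b<a
... | inj₁ (refl , b∈vs) | inj₁ (refl , _)  = All.lookup v∉vs b∈vs refl
... | inj₁ (refl , _)    | inj₂ b<a′        = All.lookup v∉vs (<-∈ʳ b<a′) refl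
... | inj₂ a<b′          | inj₁ (refl , _)  = All.lookup v∉vs (<-∈ʳ a<b′) refl
... | inj₂ a<b′          | inj₂ b<a′        = <-asym u a<b′ b<a′

<-irrefl : Unique vs → ¬ a <[ vs ] a
<-irrefl u a<a = <-asym u a<a a<a

<-total : a ∈ vs → b ∈ vs → a ≢ b → a <[ vs ] b ⊎ b <[ vs ] a
<-total (here refl) (here refl) a≢b = ⊥-elim (a≢b refl)
<-total (here refl) (there b∈)  _   = inj₁ ([] , _ , refl , b∈)
<-total (there a∈)  (here refl) _   = inj₂ ([] , _ , refl , a∈)
<-total (there a∈)  (there b∈)  a≢b with <-total a∈ b∈ a≢b
... | inj₁ a<b = inj₁ (<-∷ a<b)
... | inj₂ b<a = inj₂ (<-∷ b<a)

<-resp-⊆ : us ⊆ vs → a <[ us ] b → a <[ vs ] b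
<-resp-⊆ []         ([] , _ , () , _)
<-resp-⊆ []         (_ ∷ _ , _ , () , _)
<-resp-⊆ (_ ∷ʳ us⊆) a<b = <-∷ (<-resp-⊆ us⊆ a<b)
<-resp-⊆ (refl ∷ us⊆) a<b with <-∷⁻ a<b
... | inj₁ (refl , b∈) = [] , _ , refl , Any-resp-⊆ us⊆ b∈
... | inj₂ a<b′        = <-∷ (<-resp-⊆ us⊆ a<b′)

module _ (G : Graph n) where
  open Graph G using (adj) renaming (sym to adj-sym)

  Edge-sym : ∀ {u v} → Edge G u v → Edge G v u
  Edge-sym {u} {v} uv = trans (adj-sym v u) uv

  lastSat-nothing : ∀ p us → lastSat G p us ≡ nothing → All (λ v → p v ≡ false) us
  lastSat-nothing p []       _ = All.[]
  lastSat-nothing p (v ∷ vs) e with lastSat G p vs in e₁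
  lastSat-nothing p (v ∷ vs) () | just _
  ... | nothing with p v in e₂
  lastSat-nothing p (v ∷ vs) () | nothing | true
  ... | false = e₂ All.∷ lastSat-nothing p vs e₁

  lastSat-just : ∀ p us {y} → lastSat G p us ≡ just y →
                 ∃[ as ] ∃[ bs ] (us ≡ as ++ y ∷ bs × p y ≡ true × All (λ v → p v ≡ false) bs)
  lastSat-just p []       ()
  lastSat-just p (v ∷ vs) e with lastSat G p vs in e₁
  lastSat-just p (v ∷ vs) refl | just _ with lastSat-just p vs e₁
  ... | as , bs , refl , py , rest = v ∷ as , bs , refl , py , rest
  lastSat-just p (v ∷ vs) e | nothing with p v in e₂
  lastSat-just p (v ∷ vs) refl | nothing | true = [] , vs , refl , e₂ , lastSat-nothing p vs e₁
  lastSat-just p (v ∷ vs) ()   | nothing | false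

  lastSat-∈ : ∀ p us {y} → lastSat G p us ≡ just y → y ∈ us × p y ≡ true
  lastSat-∈ p us e with lastSat-just p us e
  ... | as , _ , refl , py , _ = ∈-++⁺ʳ as (here refl) , py

  lastSat-rightmost : ∀ p us {x y} → lastSat G p us ≡ just y → x ∈ us → p x ≡ true →
                      x ≡ y ⊎ x <[ us ] y
  lastSat-rightmost p us {x} {y} e x∈us px with lastSat-just p us e
  ... | as , bs , refl , _ , rest with ∈-++⁻ as x∈us
  ...   | inj₂ (here x≡y)  = inj₁ x≡y
  ...   | inj₂ (there x∈bs) with () ← trans (sym px) (All.lookup rest x∈bs)
  ...   | inj₁ x∈as with ∈-∃++ x∈as
  ...     | as₁ , as₂ , refl =
              inj₂ (as₁ , as₂ ++ y ∷ bs , ++-assoc as₁ (x ∷ as₂) (y ∷ bs) , ∈-++⁺ʳ as₂ (here refl))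

  choose-just : ∀ cur us {y} → choose G cur us ≡ just y →
                lastSat G (λ _ → true) us ≡ just y
                ⊎ ∃[ c ] (cur ≡ just c × lastSat G (adj c) us ≡ just y)
  choose-just nothing  us e = inj₁ e
  choose-just (just c) us e with lastSat G (adj c) us in e₁
  ... | just _  = inj₂ (c , refl , trans e₁ e)
  ... | nothing = inj₁ e

  choose-∈ : ∀ cur us {y} → choose G cur us ≡ just y → y ∈ us
  choose-∈ cur us e with choose-just cur us e
  ... | inj₁ e₁           = lastSat-∈ _ us e₁ .proj₁
  ... | inj₂ (c , _ , e₁) = lastSat-∈ _ us e₁ .proj₁

  rmnGo-∈ : ∀ k cur us {v} → v ∈ rmnGo G k cur us → v ∈ us
  rmnGo-∈ (suc k) cur us v∈ with choose G cur us in e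
  ... | just y with v∈
  ...   | here refl = choose-∈ cur us e
  ...   | there v∈′ = Any-resp-⊆ (filter-⊆ _ us) (rmnGo-∈ k (just y) (remove G y us) v∈′)

  lastVisited : Maybe (Fin n) → List (Fin n) → Maybe (Fin n)
  lastVisited = foldl (λ _ → just)

  rmnGo-choose : ∀ k cur us {y bs} → rmnGo G k cur us ≡ y ∷ bs → choose G cur us ≡ just y
  rmnGo-choose (suc k) cur us e with choose G cur us
  ... | just y with refl ← e = refl

  ∉-remove : ∀ y us → y ∉ remove G y us
  ∉-remove y us y∈ = ∈-filter⁻ (λ v → ¬? (v ≟ y)) {xs = us} y∈ .proj₂ refl

  rmnGo-suffix : ∀ k cur us as bs → rmnGo G k cur us ≡ as ++ bs → Maybe.All (_∉ us) cur →
                 ∃[ k′ ] ∃[ us′ ] (rmnGo G k′ (lastVisited cur as) us′ ≡ bs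
                                  × us′ ⊆ us × Maybe.All (_∉ us′) (lastVisited cur as))
  rmnGo-suffix k cur us [] bs e fresh = k , us , e , ⊆-refl , fresh
  rmnGo-suffix (suc k) cur us (a ∷ as) bs e fresh with choose G cur us
  ... | just y with refl , e′ ← ∷-injective e
    with k′ , us′ , e″ , us′⊆ , fresh′ ←
           rmnGo-suffix k (just y) (remove G y us) as bs e′ (just (∉-remove y us))
      = k′ , us′ , e″ , ⊆-trans us′⊆ (filter-⊆ _ us) , fresh′

  module _ {π : List (Fin n)} (π-unique : Unique π) where

    lastSat-rightmost-⊆ : ∀ p us {x y} → us ⊆ π → lastSat G p us ≡ just y → x ∈ us →
                           y <[ π ] x → p x ≢ true
    lastSat-rightmost-⊆ p us us⊆π e x∈us y<x px with lastSat-rightmost p us e x∈us px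
    ... | inj₁ refl = <-irrefl π-unique y<x
    ... | inj₂ x<y  = <-asym π-unique y<x (<-resp-⊆ us⊆π x<y)

    rmnGo-head : ∀ k cur us {y bs x} → us ⊆ π → Maybe.All (_∉ us) cur →
                 rmnGo G k cur us ≡ y ∷ bs → x ∈ bs → y <[ π ] x →
                 ∃[ z ] (cur ≡ just z × Edge G z y × ¬ Edge G z x × z ≢ x)
    rmnGo-head k cur us us⊆π fresh e x∈bs y<x
      with x∈us ← rmnGo-∈ k cur us (subst (_ ∈_) (sym e) (there x∈bs))
      with choose-just cur us (rmnGo-choose k cur us e)
    ... | inj₁ e₁ = ⊥-elim (lastSat-rightmost-⊆ _ us us⊆π e₁ x∈us y<x refl)
    ... | inj₂ (z , refl , e₁) with fresh
    ...   | just z∉us =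
            z , refl , lastSat-∈ _ us e₁ .proj₂ , lastSat-rightmost-⊆ _ us us⊆π e₁ x∈us y<x ,
            λ { refl → z∉us x∈us }

    rmn-first : ∀ {y bs x} → RMN G π ≡ y ∷ bs → x ∈ bs → ¬ y <[ π ] x
    rmn-first e x∈bs y<x with rmnGo-head (length π) nothing π ⊆-refl nothing e x∈bs y<x
    ... | _ , () , _

    rmn-predecessor : ∀ ps {z y bs x} → RMN G π ≡ ps ++ z ∷ y ∷ bs → x ∈ bs → y <[ π ] x →
                      Edge G z y × ¬ Edge G z x × z ≢ x
    rmn-predecessor ps {z} {y} {bs} e x∈bs y<x
      with k , us , e′ , us⊆π , fresh ← rmnGo-suffix (length π) nothing π (ps ++ z ∷ []) (y ∷ bs)
                                          (trans e (sym (∷ʳ-++ ps z (y ∷ bs)))) nothing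
      with z′ , cur≡z′ , zy , ¬zx , z≢x ← rmnGo-head k _ us us⊆π fresh e′ x∈bs y<x
      with refl ← trans (sym (foldl-∷ʳ (λ _ → just) nothing z ps)) cur≡z′
      = zy , ¬zx , z≢x

    module _ (π-total : ∀ v → v ∈ π) (umbrella-free : UmbrellaFree G π) where

      rmn-predecessor-right : ∀ {as} → Reverse as → ∀ {y bs x} →
                              RMN G π ≡ as ++ y ∷ bs → x ∈ bs → y <[ π ] x →
                              ∃[ z ] ∃[ ps ] (RMN G π ≡ ps ++ z ∷ y ∷ bs
                                             × x <[ π ] z × Edge G z y × ¬ Edge G z x)
      rmn-predecessor-right [] e x∈bs y<x = ⊥-elim (rmn-first e x∈bs y<x)
      rmn-predecessor-right (ps ∶ rs ∶ʳ z) {y} {bs} {x} e x∈bs y<x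
        with e′ ← trans e (∷ʳ-++ ps z (y ∷ bs))
        with zy , ¬zx , z≢x ← rmn-predecessor ps e′ x∈bs y<x
        with <-total (π-total z) (π-total x) z≢x
      ... | inj₂ x<z = z , ps , e′ , x<z , zy , ¬zx
      ... | inj₁ z<x
        with _ , _ , _ , x<w , wz , ¬wx ← rmn-predecessor-right rs e′ (there x∈bs) z<x
        with umbrella-free _ _ _ z<x x<w (Edge-sym wz)
      ... | inj₁ zx = ⊥-elim (¬zx zx)
      ... | inj₂ xw = ⊥-elim (¬wx (Edge-sym xw))

lemma6 : {n : ℕ} (G : Graph n) → Cocomparability G →
         (π : List (Fin n)) → IsOrdering π → UmbrellaFree G π →
         (x y : Fin n) → y <[ π ] x → y <[ RMN G π ] x →
         ∃[ z ] ∃[ as ] ∃[ bs ]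
           (RMN G π ≡ as ++ z ∷ y ∷ bs
            × y <[ π ] x × x <[ π ] z
            × Edge G z y × ¬ Edge G z x)
lemma6 G _ π (π-unique , π-total) umbrella-free x y y<πx (as , bs , e , x∈bs)
  with z , ps , e′ , x<z , zy , ¬zx ←
         rmn-predecessor-right G π-unique π-total umbrella-free (reverseView as) e x∈bs y<πx
  = z , ps , bs , e′ , y<πx , x<z , zy , ¬zx
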